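{- Let $q$ be a prime power, $k,r,v$ positive integers, $m\in\mathbb{Z}$, and let $\mathcal{N}$ be a $q^r$-divisible set of $k$-subspaces in $\mathbb{F}_q^v$ with $n:=\#\mathcal{N}$. Then $$\tau(n,q^r,q^k,m)\cdot q^{v-2k-2r}-m(m-1)\ge 0,$$ where $\tau(n,\Delta,u,m):=\Delta^2u^2m(m-1)-n(2m-1)u(u-1)\Delta+n(u-1)\bigl(n(u-1)+1\bigr)$.
   Context: Let $\mathcal{N}$ be a set of $k$-dimensional subspaces of $\mathbb{F}_q^v$ that together span $\mathbb{F}_q^v$. For a hyperplane ($(v-1)$-dimensional subspace) $H$, write $\#(\mathcal{N}\cap H):=\#\{U\in\mathcal{N}: U\le H\}$, and let $a_i$ be the number of hyperplanes $H$ with $\#(\mathcal{N}\cap H)=i$. The set $\mathcal{N}$ is called $q^r$-divisible (for a positive integer $r$) if its elements pairwise intersect trivially and $a_i\neq 0$ only if $q^r$ divides $\#\mathcal{N}-i$. -}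

module Defs where

open import Level using (0ℓ)
open import Data.Bool using (Bool; true; false; T; _∧_)
open import Data.Bool.ListAction using (any)
import Data.Nat.Properties as ℕP
open import Data.Nat as ℕ using (ℕ; zero; suc)
open import Data.Integer as ℤ using (ℤ; +_; -[1+_])
open import Data.Rational as ℚ using (ℚ)
open import Data.Fin using (Fin)
open import Data.Vec as Vec using (Vec; []; _∷_)
open import Data.List as List using (List; []; _∷_; length)
open import Data.List.Membership.Propositional using (_∈_)
open import Data.List.Relation.Unary.Unique.Propositional using (Unique)
open import Relation.Nullary using (¬_; does)
open import Relation.Binary.Definitions using (DecidableEquality)
open import Relation.Binary.PropositionalEquality using (_≡_; _≢_)
open import Algebra.Structures using (IsCommutativeRing)
open import Data.Product using (∃)

record FiniteField : Set₁ where
  field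
    Carrier   : Set
    _+_ _*_   : Carrier → Carrier → Carrier
    -_        : Carrier → Carrier
    0# 1#     : Carrier
    isCommutativeRing : IsCommutativeRing _≡_ _+_ _*_ -_ 0# 1#
    0≢1       : 0# ≢ 1#
    inverse   : ∀ x → x ≢ 0# → ∃ λ y → x * y ≡ 1#
    _≟_       : DecidableEquality Carrier
    elements  : List Carrier
    unique    : Unique elements
    complete  : ∀ x → x ∈ elements

  order : ℕ
  order = length elements

module LinearAlgebra (F : FiniteField) where
  open FiniteField F

  Vect : ℕ → Set
  Vect v = Vec Carrier v

  zeroV : ∀ {v} → Vect v
  zeroV = Vec.replicate _ 0#

  _+V_ : ∀ {v} → Vect v → Vect v → Vect v
  _+V_ = Vec.zipWith _+_

  _·V_ : ∀ {v} → Carrier → Vect v → Vect v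
  c ·V x = Vec.map (c *_) x

  linComb : ∀ {v k} → Vec Carrier k → Vec (Vect v) k → Vect v
  linComb []       []       = zeroV
  linComb (c ∷ cs) (b ∷ bs) = (c ·V b) +V linComb cs bs

  _==V_ : ∀ {v} → Vect v → Vect v → Bool
  []       ==V []       = true
  (x ∷ xs) ==V (y ∷ ys) = does (x ≟ y) ∧ (xs ==V ys)

  allVecs : (k : ℕ) → List (Vec Carrier k)
  allVecs zero    = [] ∷ []
  allVecs (suc k) = List.concatMap (λ c → List.map (c ∷_) (allVecs k)) elements

  inSpan : ∀ {v k} → Vec (Vect v) k → Vect v → Bool
  inSpan {k = k} b x = any (λ c → linComb c b ==V x) (allVecs k)

  InSpan : ∀ {v k} → Vec (Vect v) k → Vect v → Set
  InSpan b x = T (inSpan b x)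

  LinIndep : ∀ {v k} → Vec (Vect v) k → Set
  LinIndep {k = k} b = ∀ (c : Vec Carrier k) → linComb c b ≡ zeroV → c ≡ Vec.replicate k 0#

  -- A k-dimensional subspace of F_q^v is represented by a basis: k linearly
  -- independent vectors; the subspace is their span.
  Basis : ℕ → ℕ → Set
  Basis v k = Vec (Vect v) k

  ≤? : ∀ {v k l} → Basis v k → Basis v l → Bool
  ≤? bU bW = Vec.foldr _ (λ x acc → inSpan bW x ∧ acc) true bU

  countIn : ∀ {v k l n} → (Fin n → Basis v k) → Basis v l → ℕ
  countIn {n = n} 𝒩 H = List.length (List.filterᵇ (λ i → ≤? (𝒩 i) H) (List.allFin n))

  -- all vectors of the members of 𝒩, concatenated (their span is the span of 𝒩)
  allGens : ∀ {v k n} → (Fin n → Basis v k) → Vec (Vect v) (n ℕ.* k)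
  allGens {n = n} 𝒩 = Vec.concat (Vec.tabulate 𝒩)

-- q^e for an integer exponent e, as a rational number.
-- (For q = 0 and negative e a junk value 0 is returned; never used, q ≥ 2.)

_^ℤ_ : ℕ → ℤ → ℚ
q ^ℤ (+ n) = (+ (q ℕ.^ n)) ℚ./ 1
zero ^ℤ -[1+ n ] = ℚ.0ℚ
suc q ^ℤ -[1+ n ] = (+ 1) ℚ./ (suc q ℕ.^ suc n)
  where instance _ = ℕP.m^n≢0 (suc q) (suc n)

τ : ℤ → ℤ → ℤ → ℤ → ℤ
τ n Δ u m = Δ ℤ.* Δ ℤ.* u ℤ.* u ℤ.* m ℤ.* (m ℤ.- ℤ.1ℤ)
          ℤ.- n ℤ.* ((+ 2) ℤ.* m ℤ.- ℤ.1ℤ) ℤ.* u ℤ.* (u ℤ.- ℤ.1ℤ) ℤ.* Δ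
          ℤ.+ n ℤ.* (u ℤ.- ℤ.1ℤ) ℤ.* (n ℤ.* (u ℤ.- ℤ.1ℤ) ℤ.+ ℤ.1ℤ)

-- Hyperplanes are the kernels a^⊥ of nonzero vectors a.  Let i(a) count the
-- members of 𝒩 orthogonal to a; then i(0) = n, and Δ = q^r divides n − i(a) for
-- a ≠ 0.  Since |U^⊥| = q^(v−dim U) and distinct members span a 2k-space,
--   Σₐ i(a) = n q^(v−k)   and   Σₐ i(a)² = n (n + q^k − 1) q^(v−2k).
-- f(x) = (x − (m−1)Δ)(x − mΔ) is nonnegative on multiples of Δ with
-- f(0) = m(m−1)Δ², so m(m−1)Δ² ≤ Σₐ f(n − i(a)) = q^(v−2k) τ(n, Δ, q^k, m).

module Submission where

open import Defs
open import Level using (0ℓ)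
open import Data.Bool using (Bool; true; false; T; _∧_; T?)
open import Data.Bool.Properties using (∧-assoc)
open import Data.Nat as ℕ using (ℕ; zero; suc; NonZero; _∸_)
import Data.Nat.Properties as ℕP
open import Data.Nat.Divisibility using (_∣_; divides)
open import Data.Integer as ℤ using (ℤ; +_; -[1+_]; 0ℤ; 1ℤ)
import Data.Integer.Properties as ℤP
open import Data.Integer.Tactic.RingSolver using (solve-∀)
open import Data.Rational as ℚ using (ℚ)
open import Data.Fin as Fin using (Fin)
open import Data.List as List using (List; []; _∷_; length; _++_; concatMap; allFin; filterᵇ)
import Data.List.Properties as ListP
open import Data.List.Relation.Unary.All as All using (All; []; _∷_)
open import Data.List.Relation.Unary.Any as Any using (here; there)
open import Data.List.Relation.Unary.Any.Properties using (any⁺; any⁻)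
open import Data.List.Membership.Propositional.Properties using (∈-concatMap⁺; ∈-map⁺; ∈-allFin)
import Data.List.Relation.Unary.AllPairs.Core as AllPairs
open import Data.List.Relation.Unary.Unique.Propositional using (Unique)
open import Data.List.Relation.Unary.Unique.Propositional.Properties using (allFin⁺)
open import Data.List.Membership.Propositional using (_∈_)
open import Relation.Nullary using (Dec; yes; no; does)
open import Relation.Nullary.Decidable using (dec-true; dec-false; does-⇔; toWitness; fromWitness; isYes≗does)
open import Relation.Binary.PropositionalEquality
open import Function using (_⇔_; mk⇔; Equivalence; _∘_)
open import Function.Construct.Composition using (_⇔-∘_)
open import Data.Empty using (⊥-elim)
open import Data.Product using (∃; Σ; _×_; _,_; proj₂)
open import Data.Vec as Vec using (Vec; []; _∷_)
import Data.Vec.Properties as VecP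
open import Algebra.Bundles using (CommutativeRing; AbelianGroup)
open import Relation.Binary.Definitions using (DecidableEquality)

module Sums where
  open import Data.Integer using (_+_; _*_; _≤_)

  ∑ : {A : Set} → List A → (A → ℤ) → ℤ
  ∑ []       f = 0ℤ
  ∑ (x ∷ xs) f = f x + ∑ xs f

  χ : Bool → ℤ
  χ true  = 1ℤ
  χ false = 0ℤ

  χ-idem : ∀ b → χ b * χ b ≡ χ b
  χ-idem true  = refl
  χ-idem false = refl

  χ-∧ : ∀ a b → χ (a ∧ b) ≡ χ a * χ b
  χ-∧ true  b = sym (ℤP.*-identityˡ (χ b))
  χ-∧ false b = refl

  module _ {A : Set} where

    ∑-cong : (xs : List A) {f g : A → ℤ} → (∀ x → f x ≡ g x) → ∑ xs f ≡ ∑ xs g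
    ∑-cong []       f≗g = refl
    ∑-cong (x ∷ xs) f≗g = cong₂ _+_ (f≗g x) (∑-cong xs f≗g)

    ∑-+ : (xs : List A) (f g : A → ℤ) → ∑ xs (λ x → f x + g x) ≡ ∑ xs f + ∑ xs g
    ∑-+ []       f g = refl
    ∑-+ (x ∷ xs) f g = trans (cong (_+_ (f x + g x)) (∑-+ xs f g)) (swap (f x) (g x) (∑ xs f) (∑ xs g))
      where
      swap : ∀ a b c d → a + b + (c + d) ≡ a + c + (b + d)
      swap = solve-∀

    ∑-*ˡ : (xs : List A) (c : ℤ) (f : A → ℤ) → ∑ xs (λ x → c * f x) ≡ c * ∑ xs f
    ∑-*ˡ []       c f = sym (ℤP.*-zeroʳ c)
    ∑-*ˡ (x ∷ xs) c f = trans (cong (_+_ (c * f x)) (∑-*ˡ xs c f)) (sym (ℤP.*-distribˡ-+ c (f x) (∑ xs f)))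

    ∑-*ʳ : (xs : List A) (f : A → ℤ) (c : ℤ) → ∑ xs (λ x → f x * c) ≡ ∑ xs f * c
    ∑-*ʳ xs f c = trans (∑-cong xs (λ x → ℤP.*-comm (f x) c)) (trans (∑-*ˡ xs c f) (ℤP.*-comm c (∑ xs f)))

    ∑-square : (xs : List A) (f : A → ℤ) → ∑ xs f * ∑ xs f ≡ ∑ xs (λ x → ∑ xs (λ y → f x * f y))
    ∑-square xs f = trans (sym (∑-*ʳ xs f (∑ xs f))) (∑-cong xs (λ x → sym (∑-*ˡ xs (f x) f)))

    ∑-const : (xs : List A) (c : ℤ) → ∑ xs (λ _ → c) ≡ + length xs * c
    ∑-const []       c = sym (ℤP.*-zeroˡ c)
    ∑-const (x ∷ xs) c = trans (cong (_+_ c) (∑-const xs c)) (sym (ℤP.suc-* (+ length xs) c))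

    ∑-++ : (xs ys : List A) (f : A → ℤ) → ∑ (xs ++ ys) f ≡ ∑ xs f + ∑ ys f
    ∑-++ []       ys f = sym (ℤP.+-identityˡ (∑ ys f))
    ∑-++ (x ∷ xs) ys f = trans (cong (_+_ (f x)) (∑-++ xs ys f)) (sym (ℤP.+-assoc (f x) (∑ xs f) (∑ ys f)))

    ∑-mono : (xs : List A) {f g : A → ℤ} → (∀ x → f x ≤ g x) → ∑ xs f ≤ ∑ xs g
    ∑-mono []       f≤g = ℤP.≤-refl
    ∑-mono (x ∷ xs) f≤g = ℤP.+-mono-≤ (f≤g x) (∑-mono xs f≤g)

    length-filterᵇ : (p : A → Bool) (xs : List A) → + length (filterᵇ p xs) ≡ ∑ xs (λ x → χ (p x))
    length-filterᵇ p []       = refl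
    length-filterᵇ p (x ∷ xs) with p x
    ... | true  = trans (ℤP.pos-+ 1 _) (cong (_+_ 1ℤ) (length-filterᵇ p xs))
    ... | false = trans (length-filterᵇ p xs) (sym (ℤP.+-identityˡ _))

  module _ {A B : Set} where

    ∑-concatMap : (xs : List A) (g : A → List B) (f : B → ℤ) →
      ∑ (concatMap g xs) f ≡ ∑ xs (λ x → ∑ (g x) f)
    ∑-concatMap []       g f = refl
    ∑-concatMap (x ∷ xs) g f = trans (∑-++ (g x) (concatMap g xs) f) (cong (_+_ (∑ (g x) f)) (∑-concatMap xs g f))

    ∑-map : (xs : List A) (g : A → B) (f : B → ℤ) → ∑ (List.map g xs) f ≡ ∑ xs (λ x → f (g x))
    ∑-map []       g f = refl
    ∑-map (x ∷ xs) g f = cong (_+_ (f (g x))) (∑-map xs g f)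

    ∑-swap : (xs : List A) (ys : List B) (f : A → B → ℤ) →
      ∑ xs (λ x → ∑ ys (f x)) ≡ ∑ ys (λ y → ∑ xs (λ x → f x y))
    ∑-swap []       ys f = sym (trans (∑-const ys 0ℤ) (ℤP.*-zeroʳ (+ length ys)))
    ∑-swap (x ∷ xs) ys f = trans (cong (_+_ (∑ ys (f x))) (∑-swap xs ys f)) (sym (∑-+ ys (f x) _))

  module _ {A : Set} (_≟_ : (x y : A) → Dec (x ≡ y)) where

    ∑-absent : (y : A) (xs : List A) → All (λ x → x ≢ y) xs → ∑ xs (λ x → χ (does (x ≟ y))) ≡ 0ℤ
    ∑-absent y []       []         = refl
    ∑-absent y (x ∷ xs) (x≢y ∷ ps) rewrite dec-false (x ≟ y) x≢y =
      trans (ℤP.+-identityˡ _) (∑-absent y xs ps)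

    ∑-indicator : (y : A) (xs : List A) → Unique xs → y ∈ xs → ∑ xs (λ x → χ (does (x ≟ y))) ≡ 1ℤ
    ∑-indicator y (x ∷ xs) (x∉xs AllPairs.∷ _) (here refl) rewrite dec-true (x ≟ x) refl =
      cong (_+_ 1ℤ) (∑-absent x xs (All.map (λ x≢z z≡x → x≢z (sym z≡x)) x∉xs))
    ∑-indicator y (x ∷ xs) (x∉xs AllPairs.∷ u) (there y∈xs) rewrite dec-false (x ≟ y) (λ { refl → All.lookup x∉xs y∈xs refl }) =
      trans (ℤP.+-identityˡ _) (∑-indicator y xs u y∈xs)

open Sums

-- Linear algebra over the finite field F

module Vectors (F : FiniteField) where
  open FiniteField F using (Carrier; isCommutativeRing; _≟_)
  open LinearAlgebra F

  commRing : CommutativeRing 0ℓ 0ℓ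
  commRing = record { isCommutativeRing = isCommutativeRing }

  open CommutativeRing commRing
    using (_+_; _*_; -_; 0#; 1#; +-assoc; *-assoc; *-comm; *-identityʳ; +-identityˡ; +-identityʳ;
           zeroˡ; zeroʳ; distribˡ; distribʳ; -‿inverseˡ; +-group; +-commutativeSemigroup)
  open import Algebra.Properties.Group +-group using (inverseˡ-unique; ε⁻¹≈ε)
  open import Algebra.Properties.CommutativeSemigroup +-commutativeSemigroup using (interchange)
  open import Algebra.Properties.AbelianGroup (CommutativeRing.+-abelianGroup commRing) using (⁻¹-∙-comm)
  open import Algebra.Properties.Ring (CommutativeRing.ring commRing) using (-‿distribˡ-*; -‿distribʳ-*)
  open ≡-Reasoning

  infix 4 _≟V_
  _≟V_ : ∀ {v} → DecidableEquality (Vect v)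
  _≟V_ = VecP.≡-dec _≟_

  Span : ∀ {v k} → Vec (Vect v) k → Vect v → Set
  Span {k = k} b x = ∃ λ (c : Vect k) → linComb c b ≡ x

  dot : ∀ {v} → Vect v → Vect v → Carrier
  dot []       []       = 0#
  dot (x ∷ xs) (y ∷ ys) = x * y + dot xs ys

  -- the inner products of the rows of M with a; zero iff a is orthogonal to span M
  infixl 7 _⊙_
  _⊙_ : ∀ {v d} → Vec (Vect v) d → Vect v → Vect d
  M ⊙ a = Vec.map (λ u → dot u a) M

  ⊙-++ : ∀ {v k l} (M : Vec (Vect v) k) (N : Vec (Vect v) l) (a : Vect v) →
    does ((M Vec.++ N) ⊙ a ≟V zeroV) ≡ does (M ⊙ a ≟V zeroV) ∧ does (N ⊙ a ≟V zeroV)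
  ⊙-++ []       N a = refl
  ⊙-++ (u ∷ us) N a = trans (cong (does (dot u a ≟ 0#) ∧_) (⊙-++ us N a)) (sym (∧-assoc (does (dot u a ≟ 0#)) _ _))

  dot-comm : ∀ {v} (x y : Vect v) → dot x y ≡ dot y x
  dot-comm []       []       = refl
  dot-comm (x ∷ xs) (y ∷ ys) = cong₂ _+_ (*-comm x y) (dot-comm xs ys)

  dot-zeroʳ : ∀ {v} (x : Vect v) → dot x zeroV ≡ 0#
  dot-zeroʳ []       = refl
  dot-zeroʳ (x ∷ xs) = trans (cong₂ _+_ (zeroʳ x) (dot-zeroʳ xs)) (+-identityˡ 0#)

  dot-zero-head : ∀ {v} (x₁ : Carrier) (x a : Vect v) → dot (x₁ ∷ x) (0# ∷ a) ≡ dot x a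
  dot-zero-head x₁ x a = trans (cong (_+ dot x a) (zeroʳ x₁)) (+-identityˡ (dot x a))

  ⊙-zeroV : ∀ {v d} (M : Vec (Vect v) d) → M ⊙ zeroV ≡ zeroV
  ⊙-zeroV []       = refl
  ⊙-zeroV (u ∷ us) = cong₂ _∷_ (dot-zeroʳ u) (⊙-zeroV us)

  dot-+V : ∀ {v} (x y a : Vect v) → dot (x +V y) a ≡ dot x a + dot y a
  dot-+V []       []       []       = sym (+-identityˡ 0#)
  dot-+V (x ∷ xs) (y ∷ ys) (a ∷ as) =
    trans (cong₂ _+_ (distribʳ a x y) (dot-+V xs ys as)) (interchange (x * a) (y * a) (dot xs as) (dot ys as))

  dot-·V : ∀ {v} (c : Carrier) (x a : Vect v) → dot (c ·V x) a ≡ c * dot x a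
  dot-·V c []       []       = sym (zeroʳ c)
  dot-·V c (x ∷ xs) (a ∷ as) =
    trans (cong₂ _+_ (*-assoc c x a) (dot-·V c xs as)) (sym (distribˡ c (x * a) (dot xs as)))

  dot-linComb : ∀ {v d} (c : Vect d) (M : Vec (Vect v) d) (a : Vect v) →
    dot (linComb c M) a ≡ dot c (M ⊙ a)
  dot-linComb []       []       a = trans (dot-comm zeroV a) (dot-zeroʳ a)
  dot-linComb (c ∷ cs) (u ∷ us) a = begin
    dot ((c ·V u) +V linComb cs us) a       ≡⟨ dot-+V (c ·V u) (linComb cs us) a ⟩
    dot (c ·V u) a + dot (linComb cs us) a  ≡⟨ cong₂ _+_ (dot-·V c u a) (dot-linComb cs us a) ⟩
    c * dot u a + dot cs (us ⊙ a)           ∎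

  +V-identityˡ : ∀ {v} (x : Vect v) → zeroV +V x ≡ x
  +V-identityˡ []       = refl
  +V-identityˡ (x ∷ xs) = cong₂ _∷_ (+-identityˡ x) (+V-identityˡ xs)

  +V-assoc : ∀ {v} (x y z : Vect v) → (x +V y) +V z ≡ x +V (y +V z)
  +V-assoc []       []       []       = refl
  +V-assoc (x ∷ xs) (y ∷ ys) (z ∷ zs) = cong₂ _∷_ (+-assoc x y z) (+V-assoc xs ys zs)

  ·V-zeroʳ : ∀ {v} (c : Carrier) → c ·V zeroV {v} ≡ zeroV
  ·V-zeroʳ {zero}  c = refl
  ·V-zeroʳ {suc v} c = cong₂ _∷_ (zeroʳ c) (·V-zeroʳ c)

  negV : ∀ {v} → Vect v → Vect v
  negV = Vec.map -_

  +V-inverse : ∀ {v} (x y : Vect v) → x +V y ≡ zeroV → x ≡ negV y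
  +V-inverse []       []       _ = refl
  +V-inverse (x ∷ xs) (y ∷ ys) e =
    cong₂ _∷_ (inverseˡ-unique x y (VecP.∷-injectiveˡ e)) (+V-inverse xs ys (VecP.∷-injectiveʳ e))

  linComb-zeroV : ∀ {v d} (M : Vec (Vect v) d) → linComb zeroV M ≡ zeroV
  linComb-zeroV []       = refl
  linComb-zeroV (u ∷ us) = begin
    (0# ·V u) +V linComb zeroV us ≡⟨ cong₂ _+V_ (zero-·V u) (linComb-zeroV us) ⟩
    zeroV +V zeroV                ≡⟨ +V-identityˡ zeroV ⟩
    zeroV                         ∎
    where
    zero-·V : ∀ {v} (x : Vect v) → 0# ·V x ≡ zeroV
    zero-·V []       = refl
    zero-·V (x ∷ xs) = cong₂ _∷_ (zeroˡ x) (zero-·V xs)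

  linComb-++ : ∀ {v k l} (cs : Vect k) (ds : Vect l) (M : Vec (Vect v) k) (N : Vec (Vect v) l) →
    linComb (cs Vec.++ ds) (M Vec.++ N) ≡ linComb cs M +V linComb ds N
  linComb-++ []       ds []       N = sym (+V-identityˡ (linComb ds N))
  linComb-++ (c ∷ cs) ds (u ∷ us) N =
    trans (cong ((c ·V u) +V_) (linComb-++ cs ds us N)) (sym (+V-assoc (c ·V u) (linComb cs us) (linComb ds N)))

  linComb-negV : ∀ {v l} (ds : Vect l) (N : Vec (Vect v) l) → linComb (negV ds) N ≡ negV (linComb ds N)
  linComb-negV []       []       = sym negV-zero
    where
    negV-zero : ∀ {v} → negV (zeroV {v}) ≡ zeroV
    negV-zero {zero}  = refl
    negV-zero {suc v} = cong₂ _∷_ ε⁻¹≈ε negV-zero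
  linComb-negV (d ∷ ds) (u ∷ us) = begin
    ((- d) ·V u) +V linComb (negV ds) us  ≡⟨ cong₂ _+V_ (negV-·V d u) (linComb-negV ds us) ⟩
    negV (d ·V u) +V negV (linComb ds us) ≡⟨ negV-+V (d ·V u) (linComb ds us) ⟨
    negV ((d ·V u) +V linComb ds us)      ∎
    where
    negV-·V : ∀ {v} c (x : Vect v) → (- c) ·V x ≡ negV (c ·V x)
    negV-·V c []       = refl
    negV-·V c (x ∷ xs) = cong₂ _∷_ (sym (-‿distribˡ-* c x)) (negV-·V c xs)
    negV-+V : ∀ {v} (x y : Vect v) → negV (x +V y) ≡ negV x +V negV y
    negV-+V []       []       = refl
    negV-+V (x ∷ xs) (y ∷ ys) = cong₂ _∷_ (sym (⁻¹-∙-comm x y)) (negV-+V xs ys)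

  zeroV-++ : ∀ k l → zeroV {k} Vec.++ zeroV {l} ≡ zeroV
  zeroV-++ zero    l = refl
  zeroV-++ (suc k) l = cong (0# ∷_) (zeroV-++ k l)

  independent-++ : ∀ {v k l} (M : Vec (Vect v) k) (N : Vec (Vect v) l) →
    LinIndep M → LinIndep N → (∀ x → Span M x → Span N x → x ≡ zeroV) → LinIndep (M Vec.++ N)
  independent-++ {v} {k} {l} M N indM indN trivial c e with Vec.splitAt k c
  ... | cs , ds , refl = trans (cong₂ Vec._++_ (indM cs x≡0) (indN ds y≡0)) (zeroV-++ k l)
    where
    x y : Vect v
    x = linComb cs M
    y = linComb ds N
    x+y≡0 : x +V y ≡ zeroV
    x+y≡0 = trans (sym (linComb-++ cs ds M N)) e
    x≡0 : x ≡ zeroV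
    x≡0 = trivial x (cs , refl) (negV ds , trans (linComb-negV ds N) (sym (+V-inverse x y x+y≡0)))
    y≡0 : y ≡ zeroV
    y≡0 = trans (sym (+V-identityˡ y)) (trans (cong (_+V y) (sym x≡0)) x+y≡0)

  linComb-prepend : ∀ {v l} (c hs : Vect l) (T : Vec (Vect v) l) →
    linComb c (Vec.zipWith _∷_ hs T) ≡ dot c hs ∷ linComb c T
  linComb-prepend []       []       []       = refl
  linComb-prepend (c ∷ cs) (h ∷ hs) (t ∷ ts) = cong ((c ·V (h ∷ t)) +V_) (linComb-prepend cs hs ts)

  -- the family e₁, 0 ∷ t₁, …, 0 ∷ tₗ in one dimension more
  extend : ∀ {v l} → Vec (Vect v) l → Vec (Vect (suc v)) (suc l)
  extend T = Vec.zipWith _∷_ (1# ∷ zeroV) (zeroV ∷ T)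

  linComb-extend : ∀ {v l} (c : Carrier) (cs : Vect l) (T : Vec (Vect v) l) →
    linComb (c ∷ cs) (extend T) ≡ c ∷ linComb cs T
  linComb-extend c cs T = trans (linComb-prepend (c ∷ cs) (1# ∷ zeroV) (zeroV ∷ T)) (cong₂ _∷_ head tail)
    where
    head : c * 1# + dot cs zeroV ≡ c
    head = trans (cong₂ _+_ (*-identityʳ c) (dot-zeroʳ cs)) (+-identityʳ c)
    tail : (c ·V zeroV) +V linComb cs T ≡ linComb cs T
    tail = trans (cong (_+V linComb cs T) (·V-zeroʳ c)) (+V-identityˡ (linComb cs T))

  extend-independent : ∀ {v l} (T : Vec (Vect v) l) → LinIndep T → LinIndep (extend T)
  extend-independent T indT (c ∷ cs) e =
    cong₂ _∷_ (VecP.∷-injectiveˡ e′) (indT cs (VecP.∷-injectiveʳ e′))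
    where
    e′ : c ∷ linComb cs T ≡ 0# ∷ zeroV
    e′ = trans (sym (linComb-extend c cs T)) e

  extend-span : ∀ {v l} (T : Vec (Vect v) l) x₁ x → Span (extend T) (x₁ ∷ x) ⇔ Span T x
  extend-span T x₁ x = mk⇔
    (λ { (c ∷ cs , e) → cs , VecP.∷-injectiveʳ (trans (sym (linComb-extend c cs T)) e) })
    (λ { (cs , e) → x₁ ∷ cs , trans (linComb-extend x₁ cs T) (cong (x₁ ∷_) e) })

  standardBasis : ∀ n → Vec (Vect n) n
  standardBasis zero    = []
  standardBasis (suc n) = extend (standardBasis n)

  linComb-standardBasis : ∀ {n} (c : Vect n) → linComb c (standardBasis n) ≡ c
  linComb-standardBasis []       = refl
  linComb-standardBasis (c ∷ cs) = trans (linComb-extend c cs _) (cong (c ∷_) (linComb-standardBasis cs))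

  pivot : ∀ {v} → Carrier → Vect v → Vect v → Carrier
  pivot wi x w = - wi * dot x w

  solve-first : ∀ {v} {w₁ wi : Carrier} → w₁ * wi ≡ 1# → ∀ x₁ (x w : Vect v) →
    dot (x₁ ∷ x) (w₁ ∷ w) ≡ 0# ⇔ x₁ ≡ pivot wi x w
  solve-first {w₁ = w₁} {wi} inv x₁ x w = mk⇔ to from
    where
    s : Carrier
    s = dot x w
    to : x₁ * w₁ + s ≡ 0# → x₁ ≡ - wi * s
    to e = begin
      x₁                ≡⟨ *-identityʳ x₁ ⟨
      x₁ * 1#           ≡⟨ cong (x₁ *_) (trans (sym inv) (*-comm w₁ wi)) ⟩
      x₁ * (wi * w₁)    ≡⟨ *-assoc x₁ wi w₁ ⟨
      x₁ * wi * w₁      ≡⟨ cong (_* w₁) (*-comm x₁ wi) ⟩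
      wi * x₁ * w₁      ≡⟨ *-assoc wi x₁ w₁ ⟩
      wi * (x₁ * w₁)    ≡⟨ cong (wi *_) (inverseˡ-unique (x₁ * w₁) s e) ⟩
      wi * - s          ≡⟨ -‿distribʳ-* wi s ⟨
      - (wi * s)        ≡⟨ -‿distribˡ-* wi s ⟩
      - wi * s          ∎
    from : x₁ ≡ - wi * s → x₁ * w₁ + s ≡ 0#
    from refl = begin
      - wi * s * w₁ + s    ≡⟨ cong (_+ s) (trans (-‿distribˡ-* (wi * s) w₁) (cong (_* w₁) (-‿distribˡ-* wi s))) ⟨
      - (wi * s * w₁) + s  ≡⟨ cong (λ t → - t + s) cancel ⟩
      - s + s              ≡⟨ -‿inverseˡ s ⟩
      0#                   ∎
      where
      cancel : wi * s * w₁ ≡ s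
      cancel = begin
        wi * s * w₁    ≡⟨ cong (_* w₁) (*-comm wi s) ⟩
        s * wi * w₁    ≡⟨ *-assoc s wi w₁ ⟩
        s * (wi * w₁)  ≡⟨ cong (s *_) (trans (*-comm wi w₁) inv) ⟩
        s * 1#         ≡⟨ *-identityʳ s ⟩
        s              ∎

  record KernelBasis {v} (a : Vect (suc v)) : Set where
    field
      basis       : Basis (suc v) v
      independent : LinIndep basis
      spans       : ∀ x → Span basis x ⇔ (dot x a ≡ 0#)

  -- first coordinate of a invertible: x ↦ (pivot x, x) parametrises a^⊥
  pivotKernel : ∀ {v} {a₁ ai : Carrier} {a : Vect v} → a₁ * ai ≡ 1# → KernelBasis (a₁ ∷ a)
  pivotKernel {v} {a₁} {ai} {a} inv = record { basis = H ; independent = independent ; spans = spans }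
    where
    H : Basis (suc v) v
    H = Vec.zipWith _∷_ ((- ai) ·V a) (standardBasis v)

    linComb-H : ∀ c → linComb c H ≡ pivot ai c a ∷ c
    linComb-H c = trans (linComb-prepend c _ _) (cong₂ _∷_ column (linComb-standardBasis c))
      where
      column : dot c ((- ai) ·V a) ≡ pivot ai c a
      column = trans (dot-comm c _) (trans (dot-·V (- ai) a c) (cong (- ai *_) (dot-comm a c)))

    independent : LinIndep H
    independent c e = VecP.∷-injectiveʳ (trans (sym (linComb-H c)) e)

    spans : ∀ x → Span H x ⇔ (dot x (a₁ ∷ a) ≡ 0#)
    spans (x₁ ∷ x) = mk⇔
      (λ { (c , e) → let e′ = trans (sym (linComb-H c)) e in
             Equivalence.from (solve-first inv x₁ x a)
               (subst (λ y → x₁ ≡ pivot ai y a) (VecP.∷-injectiveʳ e′) (sym (VecP.∷-injectiveˡ e′))) })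
      (λ e → x , trans (linComb-H x) (cong (_∷ x) (sym (Equivalence.to (solve-first inv x₁ x a) e))))

  -- first coordinate of a zero: a^⊥ is F × a′^⊥
  extendKernel : ∀ {v} {a : Vect (suc v)} → KernelBasis a → KernelBasis (0# ∷ a)
  extendKernel {a = a} K = record
    { basis       = extend basis
    ; independent = extend-independent basis independent
    ; spans       = λ { (x₁ ∷ x) → subst (λ t → Span (extend basis) (x₁ ∷ x) ⇔ (t ≡ 0#)) (sym (dot-zero-head x₁ x a))
                                         (spans x ⇔-∘ extend-span basis x₁ x) }
    }
    where open KernelBasis K

  kernelBasis : ∀ {v} (a : Vect (suc v)) → a ≢ zeroV → KernelBasis a
  kernelBasis (a₁ ∷ a) a≢0 with a₁ ≟ 0#
  ... | no a₁≢0 = pivotKernel (proj₂ (FiniteField.inverse F a₁ a₁≢0))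
  kernelBasis {zero}  (a₁ ∷ []) a≢0 | yes refl = ⊥-elim (a≢0 refl)
  kernelBasis {suc v} (a₁ ∷ a)  a≢0 | yes refl = extendKernel (kernelBasis a (λ a≡0 → a≢0 (cong (0# ∷_) a≡0)))

  ==V-does : ∀ {v} (x y : Vect v) → (x ==V y) ≡ does (x ≟V y)
  ==V-does []       []       = refl
  ==V-does (x ∷ xs) (y ∷ ys) = cong (does (x ≟ y) ∧_) (==V-does xs ys)

  T-==V : ∀ {v} {x y : Vect v} → T (x ==V y) ⇔ x ≡ y
  T-==V {x = x} {y} = mk⇔ (λ t → toWitness {a? = x ≟V y} (subst T (trans (==V-does x y) (sym (isYes≗does (x ≟V y)))) t))
                          (λ e → subst T (trans (isYes≗does (x ≟V y)) (sym (==V-does x y))) (fromWitness {a? = x ≟V y} e))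

  allVecs-complete : ∀ k (c : Vect k) → c ∈ allVecs k
  allVecs-complete zero    []       = here refl
  allVecs-complete (suc k) (c ∷ cs) =
    ∈-concatMap⁺ (λ c → List.map (c ∷_) (allVecs k))
      (Any.map (λ { refl → ∈-map⁺ (c ∷_) (allVecs-complete k cs) }) (FiniteField.complete F c))

  InSpan⇔Span : ∀ {v k} (b : Vec (Vect v) k) (x : Vect v) → InSpan b x ⇔ Span b x
  InSpan⇔Span {k = k} b x = mk⇔
    (λ t → let (c , t′) = Any.satisfied (any⁻ test (allVecs k) t) in c , Equivalence.to T-==V t′)
    (λ { (c , e) → any⁺ test (Any.map (λ { refl → Equivalence.from T-==V e }) (allVecs-complete k c)) })
    where
    test : Vect k → Bool
    test c = linComb c b ==V x

  ≤?-kernel : ∀ {v l} {a : Vect (suc v)} (K : KernelBasis a) (U : Vec (Vect (suc v)) l) →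
    ≤? U (KernelBasis.basis K) ≡ does (U ⊙ a ≟V zeroV)
  ≤?-kernel     K []       = refl
  ≤?-kernel {v} {a = a} K (u ∷ us) = cong₂ _∧_ inSpan-u (≤?-kernel K us)
    where
    H : Basis (suc v) v
    H = KernelBasis.basis K
    inSpan-u : inSpan H u ≡ does (dot u a ≟ 0#)
    inSpan-u = does-⇔ (KernelBasis.spans K u ⇔-∘ InSpan⇔Span H u) (T? (inSpan H u)) (dot u a ≟ 0#)

pos-^ : ∀ q k → (+ q) ℤ.^ k ≡ + (q ℕ.^ k)
pos-^ q zero    = refl
pos-^ q (suc k) = trans (cong (+ q ℤ.*_) (pos-^ q k)) (sym (ℤP.pos-* q (q ℕ.^ k)))

-- Counting vectors of F^v

module Counting (F : FiniteField) where
  open FiniteField F using (_≟_; elements; unique; complete; 0#; 1#)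
  open LinearAlgebra F
  open Vectors F
  open import Data.Integer using (_+_; _*_; _-_; _^_; _≤_)

  q : ℕ
  q = FiniteField.order F

  Q : ℤ
  Q = + q

  ∑V : ∀ k → (Vect k → ℤ) → ℤ
  ∑V k = ∑ (allVecs k)

  ∑V-suc : ∀ k (f : Vect (suc k) → ℤ) → ∑V (suc k) f ≡ ∑ elements (λ c → ∑V k (λ cs → f (c ∷ cs)))
  ∑V-suc k f = trans (∑-concatMap elements _ f) (∑-cong elements (λ c → ∑-map (allVecs k) (c ∷_) f))

  ∑V-const : ∀ k (c : ℤ) → ∑V k (λ _ → c) ≡ Q ^ k * c
  ∑V-const zero    c = trans (ℤP.+-identityʳ c) (sym (ℤP.*-identityˡ c))
  ∑V-const (suc k) c = begin
    ∑V (suc k) (λ _ → c)               ≡⟨ ∑V-suc k _ ⟩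
    ∑ elements (λ _ → ∑V k (λ _ → c))  ≡⟨ ∑-cong elements (λ _ → ∑V-const k c) ⟩
    ∑ elements (λ _ → Q ^ k * c)       ≡⟨ ∑-const elements _ ⟩
    Q * (Q ^ k * c)                    ≡⟨ ℤP.*-assoc Q (Q ^ k) c ⟨
    Q ^ suc k * c                      ∎
    where open ≡-Reasoning

  ∑V-affine : ∀ k (c d : ℤ) (g h : Vect k → ℤ) →
    ∑V k (λ x → c + d * g x + h x) ≡ Q ^ k * c + d * ∑V k g + ∑V k h
  ∑V-affine k c d g h = begin
    ∑V k (λ x → c + d * g x + h x)                     ≡⟨ ∑-+ (allVecs k) _ h ⟩
    ∑V k (λ x → c + d * g x) + ∑V k h                  ≡⟨ cong (_+ ∑V k h) (∑-+ (allVecs k) _ _) ⟩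
    ∑V k (λ _ → c) + ∑V k (λ x → d * g x) + ∑V k h     ≡⟨ cong (λ t → t + ∑V k h) (cong₂ _+_ (∑V-const k c) (∑-*ˡ (allVecs k) d g)) ⟩
    Q ^ k * c + d * ∑V k g + ∑V k h                    ∎
    where open ≡-Reasoning

  ∑V-indicator : ∀ k (y : Vect k) → ∑V k (λ x → χ (does (x ≟V y))) ≡ 1ℤ
  ∑V-indicator zero    []       = refl
  ∑V-indicator (suc k) (y ∷ ys) = begin
    ∑V (suc k) (λ x → χ (does (x ≟V y ∷ ys)))
      ≡⟨ ∑V-suc k _ ⟩
    ∑ elements (λ c → ∑V k (λ cs → χ (does (c ≟ y) ∧ does (cs ≟V ys))))
      ≡⟨ ∑-cong elements (λ c → ∑-cong (allVecs k) (λ cs → χ-∧ (does (c ≟ y)) _)) ⟩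
    ∑ elements (λ c → ∑V k (λ cs → χ (does (c ≟ y)) * χ (does (cs ≟V ys))))
      ≡⟨ ∑-cong elements (λ c → ∑-*ˡ (allVecs k) (χ (does (c ≟ y))) (λ cs → χ (does (cs ≟V ys)))) ⟩
    ∑ elements (λ c → χ (does (c ≟ y)) * ∑V k (λ cs → χ (does (cs ≟V ys))))
      ≡⟨ ∑-cong elements (λ c → trans (cong (χ (does (c ≟ y)) *_) (∑V-indicator k ys)) (ℤP.*-identityʳ _)) ⟩
    ∑ elements (λ c → χ (does (c ≟ y)))
      ≡⟨ ∑-indicator _≟_ y elements unique (complete y) ⟩
    1ℤ ∎
    where open ≡-Reasoning

  -- a field has at least the two elements 0 ≠ 1
  order≥2 : 2 ℕ.≤ q
  order≥2 = ℤ.drop‿+≤+ (begin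
    + 2                                                         ≡⟨ cong₂ _+_ (indicator 0#) (indicator 1#) ⟨
    ∑ elements (λ x → χ (does (x ≟ 0#))) + ∑ elements (λ x → χ (does (x ≟ 1#)))
                                                                ≡⟨ ∑-+ elements _ _ ⟨
    ∑ elements (λ x → χ (does (x ≟ 0#)) + χ (does (x ≟ 1#)))   ≤⟨ ∑-mono elements at-most-one ⟩
    ∑ elements (λ _ → 1ℤ)                                       ≡⟨ ∑-const elements 1ℤ ⟩
    Q * 1ℤ                                                      ≡⟨ ℤP.*-identityʳ Q ⟩
    Q                                                           ∎)
    where
    open ℤP.≤-Reasoning
    indicator : ∀ y → ∑ elements (λ x → χ (does (x ≟ y))) ≡ 1ℤ
    indicator y = ∑-indicator _≟_ y elements unique (complete y)
    at-most-one : ∀ x → χ (does (x ≟ 0#)) + χ (does (x ≟ 1#)) ≤ 1ℤ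
    at-most-one x with x ≟ 0# | x ≟ 1#
    ... | yes x≡0 | yes x≡1 = ⊥-elim (FiniteField.0≢1 F (trans (sym x≡0) x≡1))
    ... | yes _   | no _    = ℤP.≤-refl
    ... | no _    | yes _   = ℤP.≤-refl
    ... | no _    | no _    = ℤ.+≤+ ℕ.z≤n

  -- q − 1 ≠ 0, which allows cancelling the factor q − 1 in the duality below
  instance
    Q-1≢0 : ℤ.NonZero (Q - 1ℤ)
    Q-1≢0 = pred-nonZero q order≥2
      where
      pred-nonZero : ∀ n → 2 ℕ.≤ n → ℤ.NonZero (+ n - 1ℤ)
      pred-nonZero (suc (suc n)) _ = _
      pred-nonZero (suc zero) (ℕ.s≤s ())

  solutions : ∀ {v} → Vect v → ℤ
  solutions {v} w = ∑V v (λ a → χ (does (dot a w ≟ 0#)))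

  -- a nonzero linear form on F^(v+1) has q^v zeros: solve for a pivot coordinate,
  -- or drop a zero first coordinate of w
  solutions-nonzero : ∀ {v} (w : Vect (suc v)) → w ≢ zeroV → solutions w ≡ Q ^ v
  solutions-nonzero {v} (w₁ ∷ w) w≢0 with w₁ ≟ 0#
  ... | no w₁≢0 with FiniteField.inverse F w₁ w₁≢0
  ...   | wi , inv = begin
    ∑V (suc v) (λ a → χ (does (dot a (w₁ ∷ w) ≟ 0#)))
      ≡⟨ ∑V-suc v _ ⟩
    ∑ elements (λ c → ∑V v (λ cs → χ (does (dot (c ∷ cs) (w₁ ∷ w) ≟ 0#))))
      ≡⟨ ∑-swap elements (allVecs v) _ ⟩
    ∑V v (λ cs → ∑ elements (λ c → χ (does (dot (c ∷ cs) (w₁ ∷ w) ≟ 0#))))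
      ≡⟨ ∑-cong (allVecs v) (λ cs → ∑-cong elements (λ c →
           cong χ (does-⇔ (solve-first inv c cs w) (dot (c ∷ cs) (w₁ ∷ w) ≟ 0#) (c ≟ pivot wi cs w)))) ⟩
    ∑V v (λ cs → ∑ elements (λ c → χ (does (c ≟ pivot wi cs w))))
      ≡⟨ ∑-cong (allVecs v) (λ cs → ∑-indicator _≟_ _ elements unique (complete _)) ⟩
    ∑V v (λ _ → 1ℤ)
      ≡⟨ ∑V-const v 1ℤ ⟩
    Q ^ v * 1ℤ
      ≡⟨ ℤP.*-identityʳ _ ⟩
    Q ^ v ∎
    where open ≡-Reasoning
  solutions-nonzero {zero}  (w₁ ∷ []) w≢0 | yes refl = ⊥-elim (w≢0 refl)
  solutions-nonzero {suc v} (w₁ ∷ w)  w≢0 | yes refl = begin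
    ∑V (suc (suc v)) (λ a → χ (does (dot a (0# ∷ w) ≟ 0#)))
      ≡⟨ ∑V-suc (suc v) _ ⟩
    ∑ elements (λ c → ∑V (suc v) (λ cs → χ (does (dot (c ∷ cs) (0# ∷ w) ≟ 0#))))
      ≡⟨ ∑-cong elements (λ c → ∑-cong (allVecs (suc v)) (λ cs →
           cong (λ t → χ (does (t ≟ 0#))) (dot-zero-head c cs w))) ⟩
    ∑ elements (λ _ → solutions w)
      ≡⟨ ∑-cong elements (λ _ → solutions-nonzero w (λ w≡0 → w≢0 (cong (0# ∷_) w≡0))) ⟩
    ∑ elements (λ _ → Q ^ v)
      ≡⟨ ∑-const elements _ ⟩
    Q * Q ^ v ∎
    where open ≡-Reasoning

  solutions-zero : ∀ {v} → solutions (zeroV {v}) ≡ Q ^ v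
  solutions-zero {v} = begin
    ∑V v (λ a → χ (does (dot a zeroV ≟ 0#)))
      ≡⟨ ∑-cong (allVecs v) (λ a → cong χ (trans (cong (λ t → does (t ≟ 0#)) (dot-zeroʳ a)) (dec-true (0# ≟ 0#) refl))) ⟩
    ∑V v (λ _ → 1ℤ)
      ≡⟨ ∑V-const v 1ℤ ⟩
    Q ^ v * 1ℤ
      ≡⟨ ℤP.*-identityʳ _ ⟩
    Q ^ v ∎
    where open ≡-Reasoning

  -- both cases in one formula: q · #{a | a·w = 0} = q^v + [w = 0] (q − 1) q^v
  solutions-scaled : ∀ {v} (w : Vect v) → Q * solutions w ≡ Q ^ v + χ (does (w ≟V zeroV)) * ((Q - 1ℤ) * Q ^ v)
  solutions-scaled {v} w with w ≟V zeroV
  ... | yes refl = trans (cong (Q *_) (solutions-zero {v})) (split Q (Q ^ v))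
    where
    split : ∀ Q N → Q * N ≡ N + 1ℤ * ((Q - 1ℤ) * N)
    split = solve-∀
  solutions-scaled {zero}  [] | no []≢0 = ⊥-elim ([]≢0 refl)
  solutions-scaled {suc v} w  | no w≢0 =
    trans (cong (Q *_) (solutions-nonzero w w≢0)) (sym (ℤP.+-identityʳ (Q ^ suc v)))

  -- |(span M)^⊥| = #{a ∈ F^v | M ⊙ a = 0}
  perpSize : ∀ {v d} → Vec (Vect v) d → ℤ
  perpSize {v} M = ∑V v (λ a → χ (does (M ⊙ a ≟V zeroV)))

  relationSize : ∀ {v d} → Vec (Vect v) d → ℤ
  relationSize {d = d} M = ∑V d (λ c → χ (does (linComb c M ≟V zeroV)))

  ∑-solutions : ∀ {k e} (g : Vect k → Vect e) →
    Q * ∑V k (λ x → solutions (g x)) ≡ Q ^ k * Q ^ e + ∑V k (λ x → χ (does (g x ≟V zeroV))) * ((Q - 1ℤ) * Q ^ e)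
  ∑-solutions {k} {e} g = begin
    Q * ∑V k (λ x → solutions (g x))
      ≡⟨ ∑-*ˡ (allVecs k) Q _ ⟨
    ∑V k (λ x → Q * solutions (g x))
      ≡⟨ ∑-cong (allVecs k) (λ x → solutions-scaled (g x)) ⟩
    ∑V k (λ x → Q ^ e + χ (does (g x ≟V zeroV)) * R)
      ≡⟨ ∑-+ (allVecs k) _ _ ⟩
    ∑V k (λ _ → Q ^ e) + ∑V k (λ x → χ (does (g x ≟V zeroV)) * R)
      ≡⟨ cong₂ _+_ (∑V-const k (Q ^ e)) (∑-*ʳ (allVecs k) _ R) ⟩
    Q ^ k * Q ^ e + ∑V k (λ x → χ (does (g x ≟V zeroV))) * R ∎
    where
    open ≡-Reasoning
    R : ℤ
    R = (Q - 1ℤ) * Q ^ e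

  -- Double counting the pairs (a, c) with c · (M ⊙ a) = 0 in both orders
  -- relates the two kernels: |(span M)^⊥| · q^d = #relations · q^v.
  perp-relation-duality : ∀ {v d} (M : Vec (Vect v) d) → perpSize M * Q ^ d ≡ relationSize M * Q ^ v
  perp-relation-duality {v} {d} M = cancel (Q ^ v) (Q ^ d) (perpSize M) (relationSize M) (Q - 1ℤ) (begin
    Q ^ v * Q ^ d + perpSize M * ((Q - 1ℤ) * Q ^ d)    ≡⟨ ∑-solutions (M ⊙_) ⟨
    Q * ∑V v (λ a → solutions (M ⊙ a))                 ≡⟨ cong (Q *_) by-rows ⟩
    Q * ∑V d (λ c → solutions (linComb c M))           ≡⟨ ∑-solutions (λ c → linComb c M) ⟩
    Q ^ d * Q ^ v + relationSize M * ((Q - 1ℤ) * Q ^ v) ∎)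
    where
    open ≡-Reasoning
    by-rows : ∑V v (λ a → solutions (M ⊙ a)) ≡ ∑V d (λ c → solutions (linComb c M))
    by-rows = trans (∑-swap (allVecs v) (allVecs d) _) (∑-cong (allVecs d) (λ c → ∑-cong (allVecs v) (λ a →
      cong (λ t → χ (does (t ≟ 0#))) (trans (sym (dot-linComb c M a)) (dot-comm (linComb c M) a)))))
    cancel : ∀ a b x y r .{{_ : ℤ.NonZero r}} → a * b + x * (r * b) ≡ b * a + y * (r * a) → x * b ≡ y * a
    cancel a b x y r e = ℤP.*-cancelˡ-≡ r (x * b) (y * a)
      (trans (reassoc x r b) (trans (+-cancelˡ (a * b) _ _ (trans e (cong (_+ y * (r * a)) (ℤP.*-comm b a))))
        (sym (reassoc y r a))))
      where
      open import Algebra.Properties.Group (AbelianGroup.group ℤP.+-0-abelianGroup) using () renaming (∙-cancelˡ to +-cancelˡ)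
      reassoc : ∀ x r b → r * (x * b) ≡ x * (r * b)
      reassoc = solve-∀

  relationSize-independent : ∀ {v d} (M : Vec (Vect v) d) → LinIndep M → relationSize M ≡ 1ℤ
  relationSize-independent {d = d} M ind = trans
    (∑-cong (allVecs d) (λ c → cong χ (does-⇔ (mk⇔ (ind c) (λ { refl → linComb-zeroV M })) (linComb c M ≟V zeroV) (c ≟V zeroV))))
    (∑V-indicator d zeroV)

  perpSize-independent : ∀ {v d} (M : Vec (Vect v) d) → LinIndep M → perpSize M * Q ^ d ≡ Q ^ v
  perpSize-independent {v} M ind =
    trans (perp-relation-duality M) (trans (cong (_* Q ^ v) (relationSize-independent M ind)) (ℤP.*-identityˡ (Q ^ v)))

module Quadratic where
  open import Data.Integer using (_+_; _*_; _-_; -_; _≤_)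

  quadratic : (m Δ x : ℤ) → ℤ
  quadratic m Δ x = (x - (m - 1ℤ) * Δ) * (x - m * Δ)

  consecutive-nonneg : ∀ y → 0ℤ ≤ (y + 1ℤ) * y
  consecutive-nonneg (+ k)    = subst (0ℤ ≤_) (trans (ℤP.pos-* (k ℕ.+ 1) k) (cong (_* + k) (ℤP.pos-+ k 1))) (ℤ.+≤+ ℕ.z≤n)
  consecutive-nonneg -[1+ k ] = subst (0ℤ ≤_) (trans (ℤP.pos-* k (suc k)) (negate (+ k))) (ℤ.+≤+ ℕ.z≤n)
    where
    negate : ∀ K → K * (1ℤ + K) ≡ (- (1ℤ + K) + 1ℤ) * - (1ℤ + K)
    negate = solve-∀

  -- f is nonnegative on the multiples of Δ: f(tΔ) = Δ² (t−m+1)(t−m)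
  quadratic-multiple : ∀ m Δ t → 0ℤ ≤ quadratic m (+ Δ) (t * + Δ)
  quadratic-multiple m Δ t = subst₂ _≤_ (ℤP.*-zeroʳ (+ Δ * + Δ)) (sym (factor m (+ Δ) t))
    (ℤP.*-monoˡ-≤-nonNeg (+ Δ * + Δ) {{square-nonneg}} (consecutive-nonneg (t - m)))
    where
    factor : ∀ m D t → (t * D - (m - 1ℤ) * D) * (t * D - m * D) ≡ D * D * ((t - m + 1ℤ) * (t - m))
    factor = solve-∀
    square-nonneg : ℤ.NonNegative (+ Δ * + Δ)
    square-nonneg = subst ℤ.NonNegative (ℤP.pos-* Δ Δ) _

  quadratic-zero : ∀ m Δ → quadratic m Δ 0ℤ ≡ m * (m - 1ℤ) * (Δ * Δ)
  quadratic-zero m Δ = expanded m Δ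
    where
    expanded : ∀ m Δ → (0ℤ - (m - 1ℤ) * Δ) * (0ℤ - m * Δ) ≡ m * (m - 1ℤ) * (Δ * Δ)
    expanded = solve-∀

  quadratic-expand : ∀ m Δ n i → quadratic m Δ (n - i) ≡
    (n - (m - 1ℤ) * Δ) * (n - m * Δ) + - ((n - (m - 1ℤ) * Δ) + (n - m * Δ)) * i + i * i
  quadratic-expand m Δ n i = expanded m Δ n i
    where
    expanded : ∀ m Δ n i → (n - i - (m - 1ℤ) * Δ) * (n - i - m * Δ) ≡
      (n - (m - 1ℤ) * Δ) * (n - m * Δ) + - ((n - (m - 1ℤ) * Δ) + (n - m * Δ)) * i + i * i
    expanded = solve-∀

  τ-from-moments : ∀ n Δ u m N I₁ I₂ → I₁ * u ≡ n * N → I₂ * (u * u) ≡ n * (n * N + (u - 1ℤ) * N) →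
    u * u * (N * ((n - (m - 1ℤ) * Δ) * (n - m * Δ)) + - ((n - (m - 1ℤ) * Δ) + (n - m * Δ)) * I₁ + I₂)
      ≡ N * τ n Δ u m
  τ-from-moments n Δ u m N I₁ I₂ first second = begin
    u * u * (N * (A * B) + c * I₁ + I₂)                   ≡⟨ spread u N (A * B) c I₁ I₂ ⟩
    u * u * N * (A * B) + c * u * (I₁ * u) + I₂ * (u * u) ≡⟨ cong₂ (λ s t → u * u * N * (A * B) + c * u * s + t) first second ⟩
    u * u * N * (A * B) + c * u * (n * N) + n * (n * N + (u - 1ℤ) * N)
                                                          ≡⟨ collect u N n Δ m ⟩
    N * τ n Δ u m                                         ∎
    where
    open ≡-Reasoning
    A B c : ℤ
    A = n - (m - 1ℤ) * Δ
    B = n - m * Δ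
    c = - (A + B)
    spread : ∀ u N P c I₁ I₂ → u * u * (N * P + c * I₁ + I₂) ≡ u * u * N * P + c * u * (I₁ * u) + I₂ * (u * u)
    spread = solve-∀
    collect : ∀ u N n Δ m →
      u * u * N * ((n - (m - 1ℤ) * Δ) * (n - m * Δ)) + - ((n - (m - 1ℤ) * Δ) + (n - m * Δ)) * u * (n * N)
        + n * (n * N + (u - 1ℤ) * N)
      ≡ N * (Δ * Δ * u * u * m * (m - 1ℤ) - n * (+ 2 * m - 1ℤ) * u * (u - 1ℤ) * Δ + n * (u - 1ℤ) * (n * (u - 1ℤ) + 1ℤ))
    collect = solve-∀

open Quadratic

-- The first two moments of the incidence numbers i(a) of a family 𝒩

module Moments (F : FiniteField) where
  open LinearAlgebra F
  open Vectors F
  open Counting F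
  open import Data.Integer using (_+_; _*_; _-_; _^_)

  module Family {v k n : ℕ} (𝒩 : Fin n → Basis v k) (independent : ∀ i → LinIndep (𝒩 i))
           (disjoint : ∀ i j → i ≢ j → ∀ x → Span (𝒩 i) x → Span (𝒩 j) x → x ≡ zeroV) where

    incident : Fin n → Vect v → ℤ
    incident j a = χ (does (𝒩 j ⊙ a ≟V zeroV))

    incidence : Vect v → ℤ
    incidence a = ∑ (allFin n) (λ j → incident j a)

    ∑Fin-const : ∀ c → ∑ (allFin n) (λ _ → c) ≡ + n * c
    ∑Fin-const c = trans (∑-const (allFin n) c) (cong (λ l → + l * c) (ListP.length-tabulate {n = n} (λ i → i)))

    incidence-zero : incidence zeroV ≡ + n
    incidence-zero = trans
      (∑-cong (allFin n) (λ j → cong χ (dec-true (𝒩 j ⊙ zeroV ≟V zeroV) (⊙-zeroV (𝒩 j)))))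
      (trans (∑Fin-const 1ℤ) (ℤP.*-identityʳ (+ n)))

    -- Σₐ i(a) · q^k = n q^v, as each 𝒩ⱼ^⊥ has q^(v−k) elements
    first-moment : ∑V v incidence * Q ^ k ≡ + n * Q ^ v
    first-moment = begin
      ∑V v incidence * Q ^ k                         ≡⟨ cong (_* Q ^ k) (∑-swap (allVecs v) (allFin n) _) ⟩
      ∑ (allFin n) (λ j → perpSize (𝒩 j)) * Q ^ k   ≡⟨ ∑-*ʳ (allFin n) _ _ ⟨
      ∑ (allFin n) (λ j → perpSize (𝒩 j) * Q ^ k)   ≡⟨ ∑-cong (allFin n) (λ j → perpSize-independent (𝒩 j) (independent j)) ⟩
      ∑ (allFin n) (λ _ → Q ^ v)                     ≡⟨ ∑Fin-const _ ⟩
      + n * Q ^ v                                    ∎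
      where open ≡-Reasoning

    pairCount : Fin n → Fin n → ℤ
    pairCount j l = ∑V v (λ a → incident j a * incident l a)

    -- 𝒩ⱼ ⊕ 𝒩ₗ has dimension 2k for j ≠ l, and 𝒩ⱼ has dimension k
    pairCount-scaled : ∀ j l → pairCount j l * (Q ^ k * Q ^ k) ≡ Q ^ v + χ (does (l Fin.≟ j)) * ((Q ^ k - 1ℤ) * Q ^ v)
    pairCount-scaled j l with l Fin.≟ j
    ... | yes refl = begin
      pairCount l l * (Q ^ k * Q ^ k)       ≡⟨ cong (_* (Q ^ k * Q ^ k)) (∑-cong (allVecs v) (λ a → χ-idem _)) ⟩
      perpSize (𝒩 l) * (Q ^ k * Q ^ k)      ≡⟨ ℤP.*-assoc (perpSize (𝒩 l)) (Q ^ k) (Q ^ k) ⟨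
      perpSize (𝒩 l) * Q ^ k * Q ^ k        ≡⟨ cong (_* Q ^ k) (perpSize-independent (𝒩 l) (independent l)) ⟩
      Q ^ v * Q ^ k                         ≡⟨ split (Q ^ v) (Q ^ k) ⟩
      Q ^ v + 1ℤ * ((Q ^ k - 1ℤ) * Q ^ v)   ∎
      where
      open ≡-Reasoning
      split : ∀ N u → N * u ≡ N + 1ℤ * ((u - 1ℤ) * N)
      split = solve-∀
    ... | no l≢j = begin
      pairCount j l * (Q ^ k * Q ^ k)               ≡⟨ cong₂ _*_ (∑-cong (allVecs v) (λ a → both a)) (ℤP.^-distribˡ-+-* Q k k) ⟨
      perpSize (𝒩 j Vec.++ 𝒩 l) * Q ^ (k ℕ.+ k)   ≡⟨ perpSize-independent (𝒩 j Vec.++ 𝒩 l) direct ⟩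
      Q ^ v                                         ≡⟨ ℤP.+-identityʳ (Q ^ v) ⟨
      Q ^ v + 0ℤ                                    ∎
      where
      open ≡-Reasoning
      both : ∀ a → χ (does ((𝒩 j Vec.++ 𝒩 l) ⊙ a ≟V zeroV)) ≡ incident j a * incident l a
      both a = trans (cong χ (⊙-++ (𝒩 j) (𝒩 l) a)) (χ-∧ (does (𝒩 j ⊙ a ≟V zeroV)) (does (𝒩 l ⊙ a ≟V zeroV)))
      direct : LinIndep (𝒩 j Vec.++ 𝒩 l)
      direct = independent-++ (𝒩 j) (𝒩 l) (independent j) (independent l) (disjoint j l (λ j≡l → l≢j (sym j≡l)))

    -- Σₐ i(a)² · q^(2k) = n (n q^v + (q^k − 1) q^v), counting pairs (j, l)
    second-moment : ∑V v (λ a → incidence a * incidence a) * (Q ^ k * Q ^ k) ≡ + n * (+ n * Q ^ v + (Q ^ k - 1ℤ) * Q ^ v)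
    second-moment = begin
      ∑V v (λ a → incidence a * incidence a) * u²
        ≡⟨ cong (_* u²) (∑-cong (allVecs v) (λ a → ∑-square (allFin n) (λ j → incident j a))) ⟩
      ∑V v (λ a → ∑ (allFin n) (λ j → ∑ (allFin n) (λ l → incident j a * incident l a))) * u²
        ≡⟨ cong (_* u²) (trans (∑-swap (allVecs v) (allFin n) _) (∑-cong (allFin n) (λ j → ∑-swap (allVecs v) (allFin n) _))) ⟩
      ∑ (allFin n) (λ j → ∑ (allFin n) (λ l → pairCount j l)) * u²
        ≡⟨ trans (sym (∑-*ʳ (allFin n) _ u²)) (∑-cong (allFin n) (λ j → sym (∑-*ʳ (allFin n) _ u²))) ⟩
      ∑ (allFin n) (λ j → ∑ (allFin n) (λ l → pairCount j l * u²))
        ≡⟨ ∑-cong (allFin n) (λ j → ∑-cong (allFin n) (pairCount-scaled j)) ⟩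
      ∑ (allFin n) (λ j → ∑ (allFin n) (λ l → Q ^ v + χ (does (l Fin.≟ j)) * R))
        ≡⟨ ∑-cong (allFin n) row ⟩
      ∑ (allFin n) (λ _ → + n * Q ^ v + R)
        ≡⟨ ∑Fin-const _ ⟩
      + n * (+ n * Q ^ v + R) ∎
      where
      open ≡-Reasoning
      u² R : ℤ
      u² = Q ^ k * Q ^ k
      R = (Q ^ k - 1ℤ) * Q ^ v
      row : ∀ j → ∑ (allFin n) (λ l → Q ^ v + χ (does (l Fin.≟ j)) * R) ≡ + n * Q ^ v + R
      row j = trans (∑-+ (allFin n) _ _) (cong₂ _+_ (∑Fin-const (Q ^ v)) (trans (∑-*ʳ (allFin n) _ R)
        (trans (cong (_* R) (∑-indicator Fin._≟_ j (allFin n) (allFin⁺ n) (∈-allFin j))) (ℤP.*-identityˡ R))))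

module Bound (F : FiniteField) where
  open LinearAlgebra F
  open Vectors F
  open Counting F
  open import Data.Integer using (_+_; _*_; _-_; -_; _^_; _≤_; _⊖_)

  module _ {v k n : ℕ} (𝒩 : Fin n → Basis (suc v) k) (independent : ∀ i → LinIndep (𝒩 i))
           (disjoint : ∀ i j → i ≢ j → ∀ x → Span (𝒩 i) x → Span (𝒩 j) x → x ≡ zeroV)
           (Δ : ℕ) (divisible : ∀ (H : Basis (suc v) v) → LinIndep H → Δ ∣ n ∸ countIn 𝒩 H) where

    open Moments.Family F 𝒩 independent disjoint

    D : ℤ
    D = + Δ

    countIn-kernel : ∀ {a : Vect (suc v)} (K : KernelBasis a) → + countIn 𝒩 (KernelBasis.basis K) ≡ incidence a
    countIn-kernel K = trans (length-filterᵇ _ (allFin n)) (∑-cong (allFin n) (λ j → cong χ (≤?-kernel K (𝒩 j))))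

    -- #(𝒩 ∩ H) ≤ n, so the truncated difference n ∸ #(𝒩 ∩ H) is the true one
    countIn-≤ : ∀ (H : Basis (suc v) v) → countIn 𝒩 H ℕ.≤ n
    countIn-≤ H = ℕP.≤-trans (ListP.length-filter (T? ∘ (λ i → ≤? (𝒩 i) H)) (allFin n))
                             (ℕP.≤-reflexive (ListP.length-tabulate {n = n} (λ i → i)))

    -- divisibility, read through the hyperplane a^⊥: n − i(a) ∈ Δℤ for a ≠ 0
    divisible-off-zero : ∀ a → a ≢ zeroV → ∃ λ t → + n - incidence a ≡ t * D
    divisible-off-zero a a≢0 = multiple (divisible H (KernelBasis.independent K))
      where
      K : KernelBasis a
      K = kernelBasis a a≢0
      H : Basis (suc v) v
      H = KernelBasis.basis K
      c : ℕ
      c = countIn 𝒩 H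
      multiple : Δ ∣ n ∸ c → ∃ λ t → + n - incidence a ≡ t * D
      multiple (divides t n∸c≡tΔ) = + t , (begin
        + n - incidence a  ≡⟨ cong (λ i → + n - i) (countIn-kernel K) ⟨
        + n - + c          ≡⟨ ℤP.m-n≡m⊖n n c ⟩
        n ⊖ c              ≡⟨ ℤP.⊖-≥ (countIn-≤ H) ⟩
        + (n ∸ c)          ≡⟨ cong +_ n∸c≡tΔ ⟩
        + (t ℕ.* Δ)        ≡⟨ ℤP.pos-* t Δ ⟩
        + t * D            ∎)
        where open ≡-Reasoning

    -- Σₐ f(n − i(a)) ≥ f(n − i(0)) = f(0), all other terms being nonnegative
    ∑-quadratic-lower : ∀ m → quadratic m D 0ℤ ≤ ∑V (suc v) (λ a → quadratic m D (+ n - incidence a))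
    ∑-quadratic-lower m = begin
      quadratic m D 0ℤ                                              ≡⟨ only-zero ⟨
      ∑V (suc v) (λ a → χ (does (a ≟V zeroV)) * quadratic m D 0ℤ)   ≤⟨ ∑-mono (allVecs (suc v)) term ⟩
      ∑V (suc v) (λ a → quadratic m D (+ n - incidence a))          ∎
      where
      open ℤP.≤-Reasoning
      only-zero : ∑V (suc v) (λ a → χ (does (a ≟V zeroV)) * quadratic m D 0ℤ) ≡ quadratic m D 0ℤ
      only-zero = trans (∑-*ʳ (allVecs (suc v)) _ _)
        (trans (cong (_* quadratic m D 0ℤ) (∑V-indicator (suc v) zeroV)) (ℤP.*-identityˡ _))
      term : ∀ a → χ (does (a ≟V zeroV)) * quadratic m D 0ℤ ≤ quadratic m D (+ n - incidence a)
      term a with a ≟V zeroV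
      ... | yes refl = ℤP.≤-reflexive (trans (ℤP.*-identityˡ _) (cong (quadratic m D) (sym n-n)))
        where
        n-n : + n - incidence zeroV ≡ 0ℤ
        n-n = trans (cong (λ i → + n - i) incidence-zero) (ℤP.+-inverseʳ (+ n))
      ... | no a≢0 with divisible-off-zero a a≢0
      ...   | t , n-i≡tΔ = subst (λ x → 0ℤ ≤ quadratic m D x) (sym n-i≡tΔ) (quadratic-multiple m Δ t)

    ∑-quadratic-value : ∀ m → Q ^ k * Q ^ k * ∑V (suc v) (λ a → quadratic m D (+ n - incidence a))
                                ≡ Q ^ suc v * τ (+ n) D (Q ^ k) m
    ∑-quadratic-value m = begin
      Q ^ k * Q ^ k * ∑V (suc v) (λ a → quadratic m D (+ n - incidence a))
        ≡⟨ cong (Q ^ k * Q ^ k *_) (trans (∑-cong (allVecs (suc v)) (λ a → quadratic-expand m D (+ n) (incidence a)))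
                                          (∑V-affine (suc v) (A * B) (- (A + B)) incidence (λ a → incidence a * incidence a))) ⟩
      Q ^ k * Q ^ k * (Q ^ suc v * (A * B) + - (A + B) * ∑V (suc v) incidence + ∑V (suc v) (λ a → incidence a * incidence a))
        ≡⟨ τ-from-moments (+ n) D (Q ^ k) m (Q ^ suc v) _ _ first-moment second-moment ⟩
      Q ^ suc v * τ (+ n) D (Q ^ k) m ∎
      where
      open ≡-Reasoning
      A B : ℤ
      A = + n - (m - 1ℤ) * D
      B = + n - m * D

    moment-inequality : ∀ m → Q ^ k * Q ^ k * (m * (m - 1ℤ) * (D * D)) ≤ Q ^ suc v * τ (+ n) D (Q ^ k) m
    moment-inequality m = begin
      u² * (m * (m - 1ℤ) * (D * D))                          ≡⟨ cong (u² *_) (quadratic-zero m D) ⟨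
      u² * quadratic m D 0ℤ                                  ≤⟨ ℤP.*-monoˡ-≤-nonNeg u² {{u²-nonneg}} (∑-quadratic-lower m) ⟩
      u² * ∑V (suc v) (λ a → quadratic m D (+ n - incidence a)) ≡⟨ ∑-quadratic-value m ⟩
      Q ^ suc v * τ (+ n) D (Q ^ k) m                        ∎
      where
      open ℤP.≤-Reasoning
      u² : ℤ
      u² = Q ^ k * Q ^ k
      u²-nonneg : ℤ.NonNegative u²
      u²-nonneg = subst ℤ.NonNegative (sym (trans (cong₂ _*_ (pos-^ q k) (pos-^ q k)) (sym (ℤP.pos-* (q ℕ.^ k) (q ℕ.^ k))))) _

-- Passing to the rational statement

module Rationals where
  open import Data.Integer using (_+_; _*_; _-_; -_; _≤_)
  open import Data.Rational.Unnormalised as ℚᵘ using (ℚᵘ; mkℚᵘ; *≤*)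
  import Data.Rational.Unnormalised.Properties as ℚᵘP
  import Data.Rational.Properties as ℚP

  toℚᵘ-/ : ∀ i d .{{_ : NonZero d}} → ℚ.toℚᵘ (i ℚ./ d) ℚᵘ.≃ mkℚᵘ i (d ∸ 1)
  toℚᵘ-/ i (suc d) = ℚP.toℚᵘ-fromℚᵘ (mkℚᵘ i d)

  power-fraction : ∀ p e j N → e + + j ≡ + N →
    Σ ℕ λ a → Σ ℕ λ b → (ℚ.toℚᵘ (suc p ^ℤ e) ℚᵘ.≃ mkℚᵘ (+ a) b) × (suc p ℕ.^ j ℕ.* a ≡ suc p ℕ.^ N ℕ.* suc b)
  power-fraction p (+ i) j N i+j≡N = suc p ℕ.^ i , 0 , toℚᵘ-/ (+ (suc p ℕ.^ i)) 1 , (begin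
    suc p ℕ.^ j ℕ.* suc p ℕ.^ i  ≡⟨ ℕP.*-comm (suc p ℕ.^ j) _ ⟩
    suc p ℕ.^ i ℕ.* suc p ℕ.^ j  ≡⟨ ℕP.^-distribˡ-+-* (suc p) i j ⟨
    suc p ℕ.^ (i ℕ.+ j)          ≡⟨ cong (suc p ℕ.^_) (ℤP.+-injective i+j≡N) ⟩
    suc p ℕ.^ N                  ≡⟨ ℕP.*-identityʳ _ ⟨
    suc p ℕ.^ N ℕ.* 1            ∎)
    where open ≡-Reasoning
  power-fraction p -[1+ i ] j N e+j≡N = 1 , d ∸ 1 , toℚᵘ-/ 1ℤ d , (begin
    suc p ℕ.^ j ℕ.* 1                ≡⟨ ℕP.*-identityʳ _ ⟩
    suc p ℕ.^ j                      ≡⟨ cong (suc p ℕ.^_) j≡N+i+1 ⟩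
    suc p ℕ.^ (N ℕ.+ suc i)          ≡⟨ ℕP.^-distribˡ-+-* (suc p) N (suc i) ⟩
    suc p ℕ.^ N ℕ.* d                ≡⟨ cong (suc p ℕ.^ N ℕ.*_) (ℕP.m+[n∸m]≡n (ℕP.m^n>0 (suc p) (suc i))) ⟨
    suc p ℕ.^ N ℕ.* suc (d ∸ 1)      ∎)
    where
    open ≡-Reasoning
    d : ℕ
    d = suc p ℕ.^ suc i
    instance
      d≢0 : NonZero d
      d≢0 = ℕP.m^n≢0 (suc p) (suc i)
    shift : ∀ e j → j ≡ (e + j) - e
    shift = solve-∀
    j≡N+i+1 : j ≡ N ℕ.+ suc i
    j≡N+i+1 = ℤP.+-injective (trans (shift -[1+ i ] (+ j)) (cong (_- -[1+ i ]) e+j≡N))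

  nonneg-difference : ∀ (t c : ℤ) (E : ℚ) a b → ℚ.toℚᵘ E ℚᵘ.≃ mkℚᵘ (+ a) b → c * + suc b ≤ t * + a →
    ℚ.0ℚ ℚ.≤ ℚ._-_ (ℚ._*_ (t ℚ./ 1) E) (c ℚ./ 1)
  nonneg-difference t c E a b E≃ c≤t = ℚP.toℚᵘ-cancel-≤ (ℚᵘP.≤-respʳ-≃ (ℚᵘP.≃-sym as-fraction) (nonneg-numerator W≥0))
    where
    W : ℚᵘ
    W = (mkℚᵘ t 0 ℚᵘ.* mkℚᵘ (+ a) b) ℚᵘ.+ (ℚᵘ.- mkℚᵘ c 0)
    as-fraction : ℚ.toℚᵘ (ℚ._-_ (ℚ._*_ (t ℚ./ 1) E) (c ℚ./ 1)) ℚᵘ.≃ W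
    as-fraction = ℚᵘP.≃-trans (ℚP.toℚᵘ-homo-+ (ℚ._*_ (t ℚ./ 1) E) (ℚ.- (c ℚ./ 1)))
      (ℚᵘP.+-cong (ℚᵘP.≃-trans (ℚP.toℚᵘ-homo-* (t ℚ./ 1) E) (ℚᵘP.*-cong (toℚᵘ-/ t 1) E≃))
                  (ℚᵘP.≃-trans (ℚP.toℚᵘ-homo‿- (c ℚ./ 1)) (ℚᵘP.-‿cong (toℚᵘ-/ c 1))))
    W≥0 : 0ℤ ≤ ℚᵘ.↥ W
    W≥0 = subst (0ℤ ≤_) (sym (numerator t (+ a) c (+ suc b))) (ℤP.i≤j⇒0≤j-i c≤t)
      where
      numerator : ∀ t a c s → t * a * 1ℤ + - c * (1ℤ * s) ≡ t * a - c * s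
      numerator = solve-∀
    nonneg-numerator : ∀ {p} → 0ℤ ≤ ℚᵘ.↥ p → ℚᵘ.0ℚᵘ ℚᵘ.≤ p
    nonneg-numerator {mkℚᵘ i d} 0≤i = *≤* (subst₂ _≤_ (sym (ℤP.*-zeroˡ (+ suc d))) (sym (ℤP.*-identityʳ i)) 0≤i)

  rational-bound : ∀ q → 1 ℕ.≤ q → ∀ (e : ℤ) j N (t c : ℤ) → e + + j ≡ + N → + (q ℕ.^ j) * c ≤ + (q ℕ.^ N) * t →
    ℚ.0ℚ ℚ.≤ ℚ._-_ (ℚ._*_ (t ℚ./ 1) (q ^ℤ e)) (c ℚ./ 1)
  rational-bound (suc p) _ e j N t c e+j≡N bound with power-fraction p e j N e+j≡N
  ... | a , b , E≃ , scaling = nonneg-difference t c _ a b E≃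
    (ℤP.*-cancelˡ-≤-pos (c * + suc b) (t * + a) P {{ℤ.positive (ℤ.+<+ (ℕP.m^n>0 (suc p) j))}} (begin
      P * (c * + suc b)        ≡⟨ ℤP.*-assoc P c (+ suc b) ⟨
      P * c * + suc b          ≤⟨ ℤP.*-monoʳ-≤-nonNeg (+ suc b) bound ⟩
      + (suc p ℕ.^ N) * t * + suc b  ≡⟨ swap (+ (suc p ℕ.^ N)) t (+ suc b) ⟩
      t * (+ (suc p ℕ.^ N) * + suc b) ≡⟨ cong (t *_) scalingℤ ⟨
      t * (P * + a)            ≡⟨ swap′ t P (+ a) ⟩
      P * (t * + a)            ∎))
    where
    open ℤP.≤-Reasoning
    P : ℤ
    P = + (suc p ℕ.^ j)
    scalingℤ : P * + a ≡ + (suc p ℕ.^ N) * + suc b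
    scalingℤ = trans (sym (ℤP.pos-* (suc p ℕ.^ j) a)) (trans (cong +_ scaling) (ℤP.pos-* (suc p ℕ.^ N) (suc b)))
    swap : ∀ x t s → x * t * s ≡ t * (x * s)
    swap = solve-∀
    swap′ : ∀ t x a → t * (x * a) ≡ x * (t * a)
    swap′ = solve-∀

open Rationals

module Exponents where
  open import Data.Integer using (_+_; _*_; _-_; _^_; _≤_)

  exponent-sum : ∀ v k r → + v - + (2 ℕ.* k) - + (2 ℕ.* r) + + (2 ℕ.* k ℕ.+ 2 ℕ.* r) ≡ + v
  exponent-sum v k r = trans (cong (_+_ (+ v - + (2 ℕ.* k) - + (2 ℕ.* r))) (ℤP.pos-+ (2 ℕ.* k) (2 ℕ.* r))) (cancel (+ v) (+ (2 ℕ.* k)) (+ (2 ℕ.* r)))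
    where
    cancel : ∀ V A B → V - A - B + (A + B) ≡ V
    cancel = solve-∀

  collect-powers : ∀ q k r N n m →
    (+ q) ^ k * (+ q) ^ k * (m * (m - 1ℤ) * (+ (q ℕ.^ r) * + (q ℕ.^ r))) ≤ (+ q) ^ N * τ (+ n) (+ (q ℕ.^ r)) ((+ q) ^ k) m →
    + (q ℕ.^ (2 ℕ.* k ℕ.+ 2 ℕ.* r)) * (m * (m - 1ℤ)) ≤ + (q ℕ.^ N) * τ (+ n) (+ (q ℕ.^ r)) (+ (q ℕ.^ k)) m
  collect-powers q k r N n m = subst₂ _≤_
    (trans (cong₂ (λ a b → a * b * (x * R)) (pos-^ q k) (pos-^ q k)) lhs)
    (cong₂ (λ a u → a * τ (+ n) (+ (q ℕ.^ r)) u m) (pos-^ q N) (pos-^ q k))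
    where
    x R : ℤ
    x = m * (m - 1ℤ)
    R = + (q ℕ.^ r) * + (q ℕ.^ r)
    square : ∀ e → + (q ℕ.^ (2 ℕ.* e)) ≡ + (q ℕ.^ e) * + (q ℕ.^ e)
    square e = trans (cong (λ d → + (q ℕ.^ (e ℕ.+ d))) (ℕP.+-identityʳ e))
                     (trans (cong +_ (ℕP.^-distribˡ-+-* q e e)) (ℤP.pos-* (q ℕ.^ e) (q ℕ.^ e)))
    regroup : ∀ U R x → U * (x * R) ≡ U * R * x
    regroup = solve-∀
    lhs : + (q ℕ.^ k) * + (q ℕ.^ k) * (x * R) ≡ + (q ℕ.^ (2 ℕ.* k ℕ.+ 2 ℕ.* r)) * x
    lhs = trans (regroup (+ (q ℕ.^ k) * + (q ℕ.^ k)) R x) (cong (_* x) (sym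
            (trans (cong +_ (ℕP.^-distribˡ-+-* q (2 ℕ.* k) (2 ℕ.* r)))
              (trans (ℤP.pos-* (q ℕ.^ (2 ℕ.* k)) (q ℕ.^ (2 ℕ.* r))) (cong₂ _*_ (square k) (square r))))))

open Exponents

-- The theorem: Bound gives q^(2k) · m(m−1) q^(2r) ≤ q^v τ, collect-powers rewrites
-- the left side as q^(2k+2r) m(m−1), and rational-bound divides by q^(2k+2r).
-- Dimension v = 0 is excluded by hypothesis; the spanning hypothesis is unused.
lemma4 : (q k r v : ℕ) → NonZero k → NonZero r → NonZero v → (m : ℤ) →
    (F : FiniteField) → FiniteField.order F ≡ q →
    let open LinearAlgebra F in
    (n : ℕ) (𝒩 : Fin n → Basis v k) →
    (∀ i → LinIndep (𝒩 i)) →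
    (∀ i j → i ≢ j → ∀ x → InSpan (𝒩 i) x → InSpan (𝒩 j) x → x ≡ zeroV) →
    (∀ x → InSpan (allGens 𝒩) x) →
    (∀ (H : Basis v (v ∸ 1)) → LinIndep H → (q ℕ.^ r) ∣ (n ∸ countIn 𝒩 H)) →
    ℚ.0ℚ ℚ.≤ ℚ._-_ (ℚ._*_ (τ (+ n) (+ (q ℕ.^ r)) (+ (q ℕ.^ k)) m ℚ./ 1)
                          (q ^ℤ (+ v ℤ.- + (2 ℕ.* k) ℤ.- + (2 ℕ.* r))))
                   (m ℤ.* (m ℤ.- ℤ.1ℤ) ℚ./ 1)
lemma4 q k r zero    _ _ v≢0 m F _    n 𝒩 independent disjoint _ divisible = ⊥-elim (ℕ.NonZero.nonZero v≢0)
lemma4 q k r (suc v) _ _ _   m F refl n 𝒩 independent disjoint _ divisible =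
  rational-bound q (ℕP.≤-trans (ℕ.s≤s ℕ.z≤n) order≥2) e (2 ℕ.* k ℕ.+ 2 ℕ.* r) (suc v) t (m ℤ.* (m ℤ.- ℤ.1ℤ))
    (exponent-sum (suc v) k r)
    (collect-powers q k r (suc v) n m (moment-inequality 𝒩 independent disjoint′ (q ℕ.^ r) divisible m))
  where
  open Counting F using (order≥2)
  open Vectors F using (Span; InSpan⇔Span)
  open Bound F using (moment-inequality)
  open LinearAlgebra F using (Vect; zeroV)
  e t : ℤ
  e = + suc v ℤ.- + (2 ℕ.* k) ℤ.- + (2 ℕ.* r)
  t = τ (+ n) (+ (q ℕ.^ r)) (+ (q ℕ.^ k)) m
  disjoint′ : ∀ i j → i ≢ j → ∀ (x : Vect (suc v)) → Span (𝒩 i) x → Span (𝒩 j) x → x ≡ zeroV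
  disjoint′ i j i≢j x xᵢ xⱼ = disjoint i j i≢j x (Equivalence.from (InSpan⇔Span (𝒩 i) x) xᵢ)
                                                 (Equivalence.from (InSpan⇔Span (𝒩 j) x) xⱼ)
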